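{- Let $k \ge 2$ and $n \geq 4k$ be integers, and work in $\mathbb{Z}_n = \{1,\dots,n\}$ with addition modulo $n$. For $i \in \mathbb{Z}_n$ define $A_{1,i} = \mathbb{Z}_n \setminus \{i\}$, $A_{j,i} = \mathbb{Z}_n \setminus \{ i-(j-1), i+(j-1)\}$ for $2 \le j \le k-1$, and $A_{k,i} = \{ i-k+2, i-k+3, \ldots, i+k-2 \}$. For $\mathbf{i} = (i_1, \ldots, i_{k-1}) \in \mathbb{Z}_n^{k-1}$ let $A(\mathbf{i}) = \mathbb{Z}_n \setminus (A_{1,i_1} \cap \cdots \cap A_{k-1,i_{k-1}})$. If $i_k \in \mathbb{Z}_n$ and $A(\mathbf{i}) = A_{k, i_k}$, then $i_1 = i_2 = \cdots = i_k$. -}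

module Defs where

open import Data.Nat using (ℕ; zero; suc; _+_; _*_; _∸_; _≤_; NonZero)
open import Data.Nat.DivMod using (_mod_)
open import Data.Fin using (Fin; toℕ)
open import Data.Product using (Σ; _×_)
open import Relation.Binary.PropositionalEquality using (_≡_)
open import Relation.Nullary using (¬_)

-- ℤ_n is modelled as Fin n = {0,…,n-1} (residues mod n; the paper's label n is our 0).
module _ (n : ℕ) .{{_ : NonZero n}} where

  _⊕_ : Fin n → ℕ → Fin n
  i ⊕ d = (toℕ i + d) mod n

  -- i - d (mod n); only used with d ≤ n (here d ≤ k - 2 < n)
  _⊖_ : Fin n → ℕ → Fin n
  i ⊖ d = (toℕ i + (n ∸ d)) mod n

  A : ℕ → Fin n → Fin n → Set
  A (suc zero) i x = ¬ (x ≡ i)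
  A j          i x = ¬ (x ≡ i ⊖ (j ∸ 1)) × ¬ (x ≡ i ⊕ (j ∸ 1))

  Ak : ℕ → Fin n → Fin n → Set
  Ak k i x = Σ ℕ λ t → t ≤ 2 * (k ∸ 2) × x ≡ (i ⊖ (k ∸ 2)) ⊕ t

  -- membership in A(i) = ℤ_n \ (A_{1,i_1} ∩ … ∩ A_{k-1,i_{k-1}});
  -- the tuple is indexed by j : Fin (k-1), component j standing for i_{j+1}
  Aof : (k : ℕ) → (Fin (k ∸ 1) → Fin n) → Fin n → Set
  Aof k is x = ¬ ((j : Fin (k ∸ 1)) → A (suc (toℕ j)) (is j) x)

-- Write k = K + 2 and b = i_k − K, so that A_{k,i_k} is the window b, b+1, …, b+2K.
-- A(i) is the union of the pairs is j ∓ j, so each pair lies in the window, at offsets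
-- p j and p j + 2 j: the ends of a segment of length 2 j inside [0, 2K] (n ≥ 4k rules out
-- wrap-around). The K + 1 segments have 2K + 1 endpoints (segment 0 is a point) covering
-- the 2K + 1 points of the window, so by pigeonhole no two endpoints coincide. Then every
-- segment is centred at K: if the longer ones are, they fill [0, K − j) and (K + j, 2K],
-- and segment j must fit in between. Hence is j = b ⊕ (p j + j) = b ⊕ K = i_k.
module Submission where

open import Data.Fin using (Fin; zero; suc; toℕ; fromℕ<; punchOut; splitAt; join)
import Data.Fin as Fin
open import Data.Fin.Induction using (>-wellFounded)
open import Data.Fin.Properties
  using (toℕ-injective; toℕ-fromℕ<; toℕ<n; punchOut-injective; injective⇒≤; any?; splitAt-join)
  renaming (_≟_ to _≟ᶠ_)
open import Data.Nat using (ℕ; zero; suc; _+_; _*_; _∸_; _≤_; _<_; z≤n; s≤s; s≤s⁻¹; NonZero; _%_)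
open import Data.Nat.DivMod using (%-distribˡ-+; m%n%n≡m%n; [m+n]%n≡m%n; m<n⇒m%n≡m)
open import Data.Nat.Properties
open import Data.Nat.Tactic.RingSolver using (solve-∀)
open import Data.Product using (∃; _×_; _,_; proj₁; proj₂)
open import Data.Sum using (_⊎_; inj₁; inj₂; [_,_]; map)
open import Data.Sum.Properties using (inj₁-injective; inj₂-injective)
open import Defs using (A; Ak; Aof)
import Defs
open import Function using (_∘_)
open import Function.Bundles using (_⇔_; mk⇔; Equivalence)
open import Function.Definitions using (Injective)
open import Induction.WellFounded using (WfRec; module All)
open import Level using (0ℓ)
open import Relation.Nullary using (¬_; yes; no; contradiction)
open import Relation.Nullary.Decidable using (_⊎-dec_)
open import Relation.Binary.PropositionalEquality
  using (_≡_; _≢_; refl; sym; trans; cong; cong₂; subst; module ≡-Reasoning)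
open import Algebra.Properties.CommutativeSemigroup +-commutativeSemigroup using (x∙yz≈y∙xz)

covering⇒injective : ∀ {m n} (f : Fin m → ℕ) → m ≤ n →
                     (∀ (t : Fin n) → ∃ λ s → f s ≡ toℕ t) → Injective _≡_ _≡_ f
covering⇒injective {suc m′} {n} f m≤n cover {x} {y} fx≡fy with x ≟ᶠ y
... | yes x≡y = x≡y
... | no x≢y = contradiction (injective⇒≤ punchOut-section-injective) (<⇒≱ m≤n)
  where
  -- a section of f is injective and misses x or y, so it injects Fin n into Fin m′
  section : Fin n → Fin (suc m′)
  section t = proj₁ (cover t)

  f∘section : ∀ {a} t → a ≡ section t → f a ≡ toℕ t
  f∘section t refl = proj₂ (cover t)

  section-injective : Injective _≡_ _≡_ section
  section-injective {t} {t′} eq =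
    toℕ-injective (trans (sym (f∘section t refl)) (f∘section t′ eq))

  avoided : ∃ λ a → ∀ t → a ≢ section t
  avoided with any? (λ t → x ≟ᶠ section t)
  ... | no x∉ = x , λ t x≡ → x∉ (t , x≡)
  ... | yes (t , x≡) = y , λ t′ y≡ → x≢y (trans x≡ (trans (cong section (same-fibre x≡ y≡)) (sym y≡)))
    where
    same-fibre : ∀ {t t′} → x ≡ section t → y ≡ section t′ → t ≡ t′
    same-fibre {t} {t′} x≡ y≡ =
      toℕ-injective (trans (sym (f∘section t x≡)) (trans fx≡fy (f∘section t′ y≡)))

  punchOut-section : Fin n → Fin m′
  punchOut-section t = punchOut (proj₂ avoided t)

  punchOut-section-injective : Injective _≡_ _≡_ punchOut-section
  punchOut-section-injective eq =
    section-injective (punchOut-injective (proj₂ avoided _) (proj₂ avoided _) eq)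

+-double : ∀ x y → x + 2 * y ≡ x + y + y
+-double = solve-∀

module ConcentricSegments (K : ℕ) (p : Fin (suc K) → ℕ)
  (fits : ∀ j → p j + 2 * toℕ j ≤ 2 * K)
  (covers : ∀ t → t ≤ 2 * K → ∃ λ j → t ≡ p j ⊎ t ≡ p j + 2 * toℕ j) where

  right : Fin (suc K) → ℕ
  right j = p j + 2 * toℕ j

  -- segment 0 is a single point, so it contributes one endpoint, not two
  endpoint : Fin (suc K) ⊎ Fin K → ℕ
  endpoint (inj₁ j) = p j
  endpoint (inj₂ j) = right (suc j)

  endpoint-covers : ∀ t → t ≤ 2 * K → ∃ λ u → endpoint u ≡ t
  endpoint-covers t t≤2K with covers t t≤2K
  ... | j     , inj₁ t≡left  = inj₁ j , sym t≡left
  ... | zero  , inj₂ t≡right = inj₁ zero , sym (trans t≡right (+-identityʳ _))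
  ... | suc j , inj₂ t≡right = inj₂ j , sym t≡right

  endpoint-injective : Injective _≡_ _≡_ endpoint
  endpoint-injective {u} {v} eq = begin
    u                            ≡⟨ splitAt-join (suc K) K u ⟨
    splitAt (suc K) (join _ _ u) ≡⟨ cong (splitAt (suc K)) join-u≡join-v ⟩
    splitAt (suc K) (join _ _ v) ≡⟨ splitAt-join (suc K) K v ⟩
    v                            ∎
    where
    open ≡-Reasoning
    endpoint∘splitAt : Fin (suc K + K) → ℕ
    endpoint∘splitAt = endpoint ∘ splitAt (suc K)

    splitAt-join-endpoint : ∀ w → endpoint∘splitAt (join _ _ w) ≡ endpoint w
    splitAt-join-endpoint w = cong endpoint (splitAt-join (suc K) K w)

    endpoint∘splitAt-injective : Injective _≡_ _≡_ endpoint∘splitAt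
    endpoint∘splitAt-injective = covering⇒injective endpoint∘splitAt
      (s≤s (≤-reflexive (cong (K +_) (sym (+-identityʳ K))))) λ t →
        let w , w↦t = endpoint-covers (toℕ t) (s≤s⁻¹ (toℕ<n t))
        in join _ _ w , trans (splitAt-join-endpoint w) w↦t

    join-u≡join-v : join (suc K) K u ≡ join (suc K) K v
    join-u≡join-v = endpoint∘splitAt-injective
      (trans (splitAt-join-endpoint u) (trans eq (sym (splitAt-join-endpoint v))))

  left-injective : Injective _≡_ _≡_ p
  left-injective eq = inj₁-injective (endpoint-injective eq)

  right-injective : Injective _≡_ _≡_ right
  right-injective {zero}  {zero}  _  = refl
  right-injective {zero}  {suc j} eq
    with () ← endpoint-injective {inj₁ zero} {inj₂ j} (trans (sym (+-identityʳ _)) eq)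
  right-injective {suc i} {zero}  eq
    with () ← endpoint-injective {inj₂ i} {inj₁ zero} (trans eq (+-identityʳ _))
  right-injective {suc i} {suc j} eq = cong suc (inj₂-injective (endpoint-injective eq))

  Centred : Fin (suc K) → Set
  Centred j = p j + toℕ j ≡ K

  -- The longer segments, centred by induction, have their endpoints in [0, K − m) and
  -- (K + m, 2K]; segment j, of length 2m, avoids them, so it is [K − m, K + m].
  centred-step : ∀ j → WfRec Fin._>_ Centred j → Centred j
  centred-step j outer-centred = ≤-antisym (≮⇒≥ no-right-collision) (≮⇒≥ no-left-collision)
    where
    m : ℕ
    m = toℕ j

    outer-segment-differs : ∀ {m′} → m < m′ → m′ ≤ K →
                            ¬ (∀ {j′} → toℕ j′ ≡ m′ → Centred j′ → j′ ≡ j)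
    outer-segment-differs {m′} m<m′ m′≤K only-j = <⇒≢ m<m′ (trans (cong toℕ (sym j′≡j)) toℕj′≡m′)
      where
      j′ : Fin (suc K)
      j′ = fromℕ< (s≤s m′≤K)
      toℕj′≡m′ : toℕ j′ ≡ m′
      toℕj′≡m′ = toℕ-fromℕ< (s≤s m′≤K)
      j′≡j : j′ ≡ j
      j′≡j = only-j toℕj′≡m′ (outer-centred (subst (m <_) (sym toℕj′≡m′) m<m′))

    no-left-collision : ¬ p j + m < K
    no-left-collision p+m<K = outer-segment-differs m<K∸p (m∸n≤m K (p j)) λ {j′} toℕj′≡K∸p centred′ →
      left-injective (+-cancelʳ-≡ (toℕ j′) _ _ (begin
        p j′ + toℕ j′       ≡⟨ centred′ ⟩
        K                   ≡⟨ m+[n∸m]≡n p≤K ⟨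
        p j + (K ∸ p j)     ≡⟨ cong (p j +_) toℕj′≡K∸p ⟨
        p j + toℕ j′        ∎))
      where
      open ≡-Reasoning
      p≤K : p j ≤ K
      p≤K = ≤-trans (m≤m+n (p j) m) (<⇒≤ p+m<K)
      m<K∸p : m < K ∸ p j
      m<K∸p = m+n≤o⇒m≤o∸n (suc m) (subst (_≤ K) (cong suc (+-comm (p j) m)) p+m<K)

    no-right-collision : ¬ K < p j + m
    no-right-collision K<p+m = outer-segment-differs m<r∸K r∸K≤K λ {j′} toℕj′≡r∸K centred′ →
      right-injective (begin
        right j′                        ≡⟨ +-double (p j′) (toℕ j′) ⟩
        p j′ + toℕ j′ + toℕ j′          ≡⟨ cong₂ _+_ centred′ toℕj′≡r∸K ⟩
        K + (right j ∸ K)               ≡⟨ m+[n∸m]≡n K≤r ⟩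
        right j                         ∎)
      where
      open ≡-Reasoning
      K+m<r : K + m < right j
      K+m<r = subst (K + m <_) (sym (+-double (p j) m)) (+-monoˡ-< m K<p+m)
      K≤r : K ≤ right j
      K≤r = ≤-trans (m≤m+n K m) (<⇒≤ K+m<r)
      m<r∸K : m < right j ∸ K
      m<r∸K = m+n≤o⇒m≤o∸n (suc m) (subst (_≤ right j) (cong suc (+-comm K m)) K+m<r)
      r∸K≤K : right j ∸ K ≤ K
      r∸K≤K = m≤n+o⇒m∸n≤o (right j) K (subst (right j ≤_) (cong (K +_) (+-identityʳ K)) (fits j))

  centred : ∀ j → Centred j
  centred = All.wfRec >-wellFounded 0ℓ Centred centred-step

module Cyclic (n : ℕ) .{{_ : NonZero n}} where

  infixl 6 _⊕_ _⊖_
  infix 4 _≡_±_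

  _⊕_ : Fin n → ℕ → Fin n
  _⊕_ = Defs._⊕_ n

  _⊖_ : Fin n → ℕ → Fin n
  _⊖_ = Defs._⊖_ n

  [m%n+o]%n≡[m+o]%n : ∀ m o → (m % n + o) % n ≡ (m + o) % n
  [m%n+o]%n≡[m+o]%n m o = begin
    (m % n + o) % n           ≡⟨ %-distribˡ-+ (m % n) o n ⟩
    (m % n % n + o % n) % n   ≡⟨ cong (λ r → (r + o % n) % n) (m%n%n≡m%n m n) ⟩
    (m % n + o % n) % n       ≡⟨ %-distribˡ-+ m o n ⟨
    (m + o) % n               ∎
    where open ≡-Reasoning

  toℕ-⊕ : ∀ i a → toℕ (i ⊕ a) ≡ (toℕ i + a) % n
  toℕ-⊕ i a = toℕ-fromℕ< _

  ⊕-assoc : ∀ i a c → i ⊕ a ⊕ c ≡ i ⊕ (a + c)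
  ⊕-assoc i a c = toℕ-injective (begin
    toℕ (i ⊕ a ⊕ c)            ≡⟨ toℕ-⊕ (i ⊕ a) c ⟩
    (toℕ (i ⊕ a) + c) % n      ≡⟨ cong (λ r → (r + c) % n) (toℕ-⊕ i a) ⟩
    ((toℕ i + a) % n + c) % n  ≡⟨ [m%n+o]%n≡[m+o]%n (toℕ i + a) c ⟩
    (toℕ i + a + c) % n        ≡⟨ cong (_% n) (+-assoc (toℕ i) a c) ⟩
    (toℕ i + (a + c)) % n      ≡⟨ toℕ-⊕ i (a + c) ⟨
    toℕ (i ⊕ (a + c))          ∎)
    where open ≡-Reasoning

  ⊕-identityʳ : ∀ i → i ⊕ 0 ≡ i
  ⊕-identityʳ i = toℕ-injective (trans (toℕ-⊕ i 0)
    (trans (cong (_% n) (+-identityʳ (toℕ i))) (m<n⇒m%n≡m (toℕ<n i))))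

  i⊕n≡i : ∀ i → i ⊕ n ≡ i
  i⊕n≡i i = toℕ-injective (trans (toℕ-⊕ i n)
    (trans ([m+n]%n≡m%n (toℕ i) n) (m<n⇒m%n≡m (toℕ<n i))))

  ⊖-⊕-cancel : ∀ i {d} → d ≤ n → i ⊖ d ⊕ d ≡ i
  ⊖-⊕-cancel i {d} d≤n = trans (⊕-assoc i (n ∸ d) d) (trans (cong (i ⊕_) (m∸n+n≡m d≤n)) (i⊕n≡i i))

  ⊖-⊕-double : ∀ i {d} → d ≤ n → i ⊖ d ⊕ 2 * d ≡ i ⊕ d
  ⊖-⊕-double i {d} d≤n = begin
    i ⊖ d ⊕ 2 * d         ≡⟨ cong (i ⊖ d ⊕_) (cong (d +_) (+-identityʳ d)) ⟩
    i ⊖ d ⊕ (d + d)       ≡⟨ ⊕-assoc (i ⊖ d) d d ⟨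
    i ⊖ d ⊕ d ⊕ d         ≡⟨ cong (_⊕ d) (⊖-⊕-cancel i d≤n) ⟩
    i ⊕ d                 ∎
    where open ≡-Reasoning

  ⊖-identityʳ : ∀ i → i ⊖ 0 ≡ i
  ⊖-identityʳ i = trans (sym (⊕-identityʳ (i ⊖ 0))) (⊖-⊕-cancel i z≤n)

  toℕ[i⊕a⊖i]≡a : ∀ i {a} → a < n → toℕ (i ⊕ a ⊖ toℕ i) ≡ a
  toℕ[i⊕a⊖i]≡a i {a} a<n = begin
    toℕ (i ⊕ a ⊖ toℕ i)              ≡⟨ cong toℕ (⊕-assoc i a (n ∸ toℕ i)) ⟩
    toℕ (i ⊕ (a + (n ∸ toℕ i)))      ≡⟨ toℕ-⊕ i (a + (n ∸ toℕ i)) ⟩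
    (toℕ i + (a + (n ∸ toℕ i))) % n  ≡⟨ cong (_% n) (x∙yz≈y∙xz (toℕ i) a (n ∸ toℕ i)) ⟩
    (a + (toℕ i + (n ∸ toℕ i))) % n  ≡⟨ cong (λ r → (a + r) % n) (m+[n∸m]≡n (<⇒≤ (toℕ<n i))) ⟩
    (a + n) % n                      ≡⟨ [m+n]%n≡m%n a n ⟩
    a % n                            ≡⟨ m<n⇒m%n≡m a<n ⟩
    a                                ∎
    where open ≡-Reasoning

  ⊕-cancelˡ : ∀ i {a c} → a < n → c < n → i ⊕ a ≡ i ⊕ c → a ≡ c
  ⊕-cancelˡ i {a} {c} a<n c<n eq = begin
    a                    ≡⟨ toℕ[i⊕a⊖i]≡a i a<n ⟨
    toℕ (i ⊕ a ⊖ toℕ i)  ≡⟨ cong (λ x → toℕ (x ⊖ toℕ i)) eq ⟩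
    toℕ (i ⊕ c ⊖ toℕ i)  ≡⟨ toℕ[i⊕a⊖i]≡a i c<n ⟩
    c                    ∎
    where open ≡-Reasoning

  _≡_±_ : Fin n → Fin n → ℕ → Set
  x ≡ i ± m = x ≡ i ⊖ m ⊎ x ≡ i ⊕ m

  A-suc⇔ : ∀ i m x → A n (suc m) i x ⇔ (¬ x ≡ i ± m)
  A-suc⇔ i zero x = mk⇔
    (λ x≢i → [ x≢i ∘ (λ e → trans e (⊖-identityʳ i)) , x≢i ∘ (λ e → trans e (⊕-identityʳ i)) ])
    (λ x≢i± x≡i → x≢i± (inj₂ (trans x≡i (sym (⊕-identityʳ i)))))
  A-suc⇔ i (suc m) x = mk⇔
    (λ (x≢i⊖m , x≢i⊕m) → [ x≢i⊖m , x≢i⊕m ])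
    (λ x≢i± → x≢i± ∘ inj₁ , x≢i± ∘ inj₂)

  Aof⇔± : ∀ k (is : Fin (k ∸ 1) → Fin n) x → Aof n k is x ⇔ (∃ λ j → x ≡ is j ± toℕ j)
  Aof⇔± k is x = mk⇔ to (λ (j , x≡±) all → Equivalence.to (A-suc⇔ (is j) (toℕ j) x) (all j) x≡±)
    where
    to : Aof n k is x → ∃ λ j → x ≡ is j ± toℕ j
    to ¬all with any? (λ j → x ≟ᶠ is j ⊖ toℕ j ⊎-dec x ≟ᶠ is j ⊕ toℕ j)
    ... | yes found = found
    ... | no none = contradiction (λ j → Equivalence.from (A-suc⇔ (is j) (toℕ j) x) (none ∘ (j ,_))) ¬all

module Window (n : ℕ) .{{_ : NonZero n}} (K : ℕ) (4k≤n : 4 * suc (suc K) ≤ n)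
  (is : Fin (suc K) → Fin n) (ik : Fin n)
  (A≡Ak : (x : Fin n) → (Aof n (suc (suc K)) is x → Ak n (suc (suc K)) ik x)
                      × (Ak n (suc (suc K)) ik x → Aof n (suc (suc K)) is x)) where

  open Cyclic n

  b : Fin n
  b = ik ⊖ K

  short : ∀ {a} → a ≤ 2 * K + 2 * K → a < n
  short a≤4K = ≤-trans (s≤s (≤-trans a≤4K (m≤m+n _ 7))) (subst (_≤ n) (4*[2+K] K) 4k≤n)
    where
    4*[2+K] : ∀ K → 4 * suc (suc K) ≡ suc (2 * K + 2 * K + 7)
    4*[2+K] = solve-∀

  K≤n : K ≤ n
  K≤n = <⇒≤ (short (≤-trans (m≤m+n K (K + 0)) (m≤m+n (2 * K) (2 * K))))

  toℕ≤K : ∀ (j : Fin (suc K)) → toℕ j ≤ K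
  toℕ≤K j = s≤s⁻¹ (toℕ<n j)

  window-cancel : ∀ {a c} → a ≤ 2 * K + 2 * K → c ≤ 2 * K + 2 * K → b ⊕ a ≡ b ⊕ c → a ≡ c
  window-cancel a≤4K c≤4K = ⊕-cancelˡ b (short a≤4K) (short c≤4K)

  in-window : ∀ j {x} → x ≡ is j ± toℕ j → ∃ λ t → t ≤ 2 * K × x ≡ b ⊕ t
  in-window j x≡± = proj₁ (A≡Ak _) (Equivalence.from (Aof⇔± (suc (suc K)) is _) (j , x≡±))

  p : Fin (suc K) → ℕ
  p j = proj₁ (in-window j (inj₁ refl))

  p≤2K : ∀ j → p j ≤ 2 * K
  p≤2K j = proj₁ (proj₂ (in-window j (inj₁ refl)))

  left-end : ∀ j → is j ⊖ toℕ j ≡ b ⊕ p j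
  left-end j = proj₂ (proj₂ (in-window j (inj₁ refl)))

  right-end : ∀ j → is j ⊕ toℕ j ≡ b ⊕ (p j + 2 * toℕ j)
  right-end j = begin
    is j ⊕ toℕ j                   ≡⟨ ⊖-⊕-double (is j) (≤-trans (toℕ≤K j) K≤n) ⟨
    is j ⊖ toℕ j ⊕ 2 * toℕ j       ≡⟨ cong (_⊕ 2 * toℕ j) (left-end j) ⟩
    b ⊕ p j ⊕ 2 * toℕ j            ≡⟨ ⊕-assoc b (p j) (2 * toℕ j) ⟩
    b ⊕ (p j + 2 * toℕ j)          ∎
    where open ≡-Reasoning

  right≤4K : ∀ j → p j + 2 * toℕ j ≤ 2 * K + 2 * K
  right≤4K j = +-mono-≤ (p≤2K j) (*-monoʳ-≤ 2 (toℕ≤K j))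

  2K≤4K : ∀ {t} → t ≤ 2 * K → t ≤ 2 * K + 2 * K
  2K≤4K t≤2K = m≤n⇒m≤n+o (2 * K) t≤2K

  fits : ∀ j → p j + 2 * toℕ j ≤ 2 * K
  fits j =
    let t , t≤2K , right≡b⊕t = in-window j (inj₂ refl)
    in subst (_≤ 2 * K) (window-cancel (2K≤4K t≤2K) (right≤4K j) (trans (sym right≡b⊕t) (right-end j))) t≤2K

  covers : ∀ t → t ≤ 2 * K → ∃ λ j → t ≡ p j ⊎ t ≡ p j + 2 * toℕ j
  covers t t≤2K =
    let j , b⊕t≡± = Equivalence.to (Aof⇔± (suc (suc K)) is (b ⊕ t))
                                    (proj₂ (A≡Ak (b ⊕ t)) (t , t≤2K , refl))
    in j , map (window-cancel (2K≤4K t≤2K) (2K≤4K (p≤2K j)) ∘ λ e → trans e (left-end j))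
               (window-cancel (2K≤4K t≤2K) (right≤4K j) ∘ λ e → trans e (right-end j)) b⊕t≡±

  open ConcentricSegments K p fits covers public using (centred)


lemma3 : (k n : ℕ) → 2 ≤ k → 4 * k ≤ n → .{{_ : NonZero n}} →
           (is : Fin (k ∸ 1) → Fin n) → (ik : Fin n) →
           ((x : Fin n) → (Aof n k is x → Ak n k ik x) × (Ak n k ik x → Aof n k is x)) →
           (j : Fin (k ∸ 1)) → is j ≡ ik
lemma3 (suc (suc K)) n (s≤s (s≤s z≤n)) 4k≤n is ik A≡Ak j = begin
  is j                 ≡⟨ ⊖-⊕-cancel (is j) (≤-trans (toℕ≤K j) K≤n) ⟨
  is j ⊖ toℕ j ⊕ toℕ j ≡⟨ cong (_⊕ toℕ j) (left-end j) ⟩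
  b ⊕ p j ⊕ toℕ j      ≡⟨ ⊕-assoc b (p j) (toℕ j) ⟩
  b ⊕ (p j + toℕ j)    ≡⟨ cong (b ⊕_) (centred j) ⟩
  b ⊕ K                ≡⟨ ⊖-⊕-cancel ik K≤n ⟩
  ik                   ∎
  where
  open Cyclic n
  open Window n K 4k≤n is ik A≡Ak
  open ≡-Reasoning
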